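{- Let $(b_n)_{n\ge1}$, $(c_n)_{n\ge 0}$ be real sequences with $c_n\neq0$ and $b_n\neq 0$ for every $n$, and let $(A_n)_{n\ge0}$, $(B_n)_{n\ge0}$ form a basis of the solution space of $$c_ny_{n+1}+c_{n-1}y_{n-1}-b_ny_n=0,\qquad n\ge 1.$$ Define, for $n\ge1$, $x_{n-1}=A_nA_{n-1}$, $y_{n-1}=B_nB_{n-1}$, $z_{n-1}=A_nB_{n-1}+A_{n-1}B_n$. Then $(x_n)$, $(y_n)$, $(z_n)$ form a basis of the solution space of the four-term recurrence relation $$c_{n+2}c_{n+1}^2b_n\,z_{n+2}+\big(b_nc_{n+1}^3-b_nb_{n+1}b_{n+2}c_{n+1}\big)z_{n+1}+\big(b_nb_{n+1}b_{n+2}c_n-b_{n+2}c_n^3\big)z_n-c_{n-1}c_n^2b_{n+2}\,z_{n-1}=0,\qquad n\ge1.$$ -}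

module Defs where

open import Level using (Level; _⊔_) renaming (suc to lsuc)
open import Data.Nat using (ℕ; zero; suc)
open import Data.Product using (Σ; ∃; _×_; _,_)
open import Relation.Nullary using (¬_)
open import Algebra.Bundles using (CommutativeRing)

record Field (c ℓ : Level) : Set (lsuc (c ⊔ ℓ)) where
  field
    commutativeRing : CommutativeRing c ℓ
  open CommutativeRing commutativeRing public
  field
    0≉1 : ¬ (0# ≈ 1#)
    inverse : ∀ x → ¬ (x ≈ 0#) → ∃ λ y → x * y ≈ 1#

module _ {c ℓ : Level} (F : Field c ℓ) where
  open Field F

  ι : ℕ → Carrier
  ι zero    = 0#
  ι (suc n) = 1# + ι n

  CharZero : Set ℓ
  CharZero = ∀ n → ¬ (ι (suc n) ≈ 0#)

  Seq : Set c
  Seq = ℕ → Carrier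

  infixr 8 _²
  infixr 8 _³
  _² : Carrier → Carrier
  x ² = x * x
  _³ : Carrier → Carrier
  x ³ = x * x * x

  -- y solves  c_n y_{n+1} + c_{n-1} y_{n-1} - b_n y_n = 0  for all n ≥ 1
  -- (written with n = suc m)
  Sol3 : (b cc : Seq) → Seq → Set ℓ
  Sol3 b cc y = ∀ m →
    cc (suc m) * y (suc (suc m)) + cc m * y m - b (suc m) * y (suc m) ≈ 0#

  -- z solves the four-term recurrence of Theorem 3.2 for all n ≥ 1
  -- (written with n = suc m, so n - 1 = m, n + 1 = suc n, n + 2 = suc (suc n))
  Sol4 : (b cc : Seq) → Seq → Set ℓ
  Sol4 b cc z = ∀ m → let n = suc m in
      cc (suc (suc n)) * cc (suc n) ² * b n * z (suc (suc n))
    + (b n * cc (suc n) ³ - b n * b (suc n) * b (suc (suc n)) * cc (suc n)) * z (suc n)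
    + (b n * b (suc n) * b (suc (suc n)) * cc n - b (suc (suc n)) * cc n ³) * z n
    - cc m * cc n ² * b (suc (suc n)) * z m
    ≈ 0#

  Basis2 : (P : Seq → Set ℓ) → Seq → Seq → Set (c ⊔ ℓ)
  Basis2 P A B =
      P A × P B
    × (∀ α β → (∀ n → α * A n + β * B n ≈ 0#) → α ≈ 0# × β ≈ 0#)
    × (∀ y → P y → ∃ λ α → ∃ λ β → ∀ n → y n ≈ α * A n + β * B n)

  Basis3 : (P : Seq → Set ℓ) → Seq → Seq → Seq → Set (c ⊔ ℓ)
  Basis3 P X Y Z =
      P X × P Y × P Z
    × (∀ α β γ → (∀ n → α * X n + β * Y n + γ * Z n ≈ 0#)
         → α ≈ 0# × β ≈ 0# × γ ≈ 0#)
    × (∀ z → P z → ∃ λ α → ∃ λ β → ∃ λ γ →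
         ∀ n → z n ≈ α * X n + β * Y n + γ * Z n)

{-# OPTIONS --safe #-}

-- Write uₙ = (Aₙ, Bₙ) ∈ F² and, for the symmetric bilinear form Q with matrix [[α, γ], [γ, β]],
-- tₙ = Q(uₙ₊₁, uₙ) and pₙ = Q(uₙ, uₙ); the sequences t are exactly α x + β y + γ z.
-- Pairing cₙuₙ₊₁ + cₙ₋₁uₙ₋₁ = bₙuₙ with uₙ and with cₙuₙ₊₁ − cₙ₋₁uₙ₋₁ gives
--   bₙpₙ = cₙtₙ + cₙ₋₁tₙ₋₁   and   cₙ²pₙ₊₁ − cₙ₋₁²pₙ₋₁ = bₙ(cₙtₙ − cₙ₋₁tₙ₋₁),
-- and eliminating p yields the four-term recurrence. Conversely every solution t of that
-- recurrence has such a companion p, and the pair (t, p) is determined by (p₀, t₀, p₁).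
-- As the Casoratian A₀B₁ − A₁B₀ is nonzero, u₀, u₁ is a basis of F², so Q is determined by,
-- and can be chosen to take, any prescribed values (Q(u₀,u₀), Q(u₁,u₀), Q(u₁,u₁)) = (p₀, t₀, p₁):
-- this is independence and spanning.
module Submission where

open import Defs
open import Level using (Level)
open import Data.Nat using (ℕ; suc)
open import Relation.Nullary using (¬_)

open import Algebra.Bundles using (CommutativeRing)
open import Data.Nat as ℕ using (zero)
import Data.Nat.Properties as ℕ
open import Data.Integer as ℤ using (ℤ; +_; -[1+_])
import Data.Integer.Properties as ℤ
open import Data.Maybe using (Maybe; just; nothing)
open import Data.Product using (∃; _×_; _,_; proj₁; proj₂)
open import Relation.Nullary using (yes; no)
import Relation.Binary.PropositionalEquality as ≡
import Algebra.Solver.Ring.AlmostCommutativeRing as ACR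

-- The ring solver needs coefficients with a decidable equality; ℤ maps into every commutative ring.
-- The optimised multiple _×′_ makes ⟦ + 0 ⟧ℤ and ⟦ + 1 ⟧ℤ reduce to 0# and 1#, so that
-- con (+ 0) and con (+ 1) denote 0# and 1# in the identities proved by solve.
module IntegerCoefficientSolver {c ℓ : Level} (R : CommutativeRing c ℓ) where
  open CommutativeRing R
  open import Algebra.Properties.Monoid.Mult.TCOptimised +-monoid using (1+×; ×-homo-+; ×-cong)
    renaming (_×_ to _×′_)
  open import Algebra.Properties.Semiring.Mult.TCOptimised semiring using (×1-homo-*)
  open import Algebra.Properties.Ring ring
    using (-0#≈0#; -‿involutive; -‿+-comm; -‿distribˡ-*; -‿distribʳ-*)
  open import Relation.Binary.Reasoning.Setoid setoid

  ⟦_⟧ℤ : ℤ → Carrier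
  ⟦ + n ⟧ℤ      = n ×′ 1#
  ⟦ -[1+ n ] ⟧ℤ = - (suc n ×′ 1#)

  ≡⇒≈ : ∀ {i j} → i ≡.≡ j → ⟦ i ⟧ℤ ≈ ⟦ j ⟧ℤ
  ≡⇒≈ ≡.refl = refl

  -‿homo : ∀ i → ⟦ ℤ.- i ⟧ℤ ≈ - ⟦ i ⟧ℤ
  -‿homo (+ zero)  = sym -0#≈0#
  -‿homo (+ suc n) = refl
  -‿homo -[1+ n ]  = sym (-‿involutive _)

  [1+x]-[1+y]≈x-y : ∀ x y → (1# + x) - (1# + y) ≈ x - y
  [1+x]-[1+y]≈x-y x y = begin
    (1# + x) - (1# + y)          ≈⟨ +-cong (+-comm x 1#) (-‿+-comm 1# y) ⟨
    (x + 1#) + (- 1# + - y)      ≈⟨ +-assoc x 1# _ ⟩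
    x + (1# + (- 1# + - y))      ≈⟨ +-congˡ (+-assoc 1# (- 1#) (- y)) ⟨
    x + ((1# - 1#) + - y)        ≈⟨ +-congˡ (+-congʳ (-‿inverseʳ 1#)) ⟩
    x + (0# + - y)               ≈⟨ +-congˡ (+-identityˡ (- y)) ⟩
    x - y                        ∎

  ⊖-homo : ∀ m n → ⟦ m ℤ.⊖ n ⟧ℤ ≈ m ×′ 1# - n ×′ 1#
  ⊖-homo m       zero    = sym (trans (+-congˡ -0#≈0#) (+-identityʳ _))
  ⊖-homo zero    (suc n) = sym (+-identityˡ _)
  ⊖-homo (suc m) (suc n) = begin
    ⟦ suc m ℤ.⊖ suc n ⟧ℤ             ≈⟨ ≡⇒≈ (ℤ.[1+m]⊖[1+n]≡m⊖n m n) ⟩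
    ⟦ m ℤ.⊖ n ⟧ℤ                     ≈⟨ ⊖-homo m n ⟩
    m ×′ 1# - n ×′ 1#                ≈⟨ [1+x]-[1+y]≈x-y _ _ ⟨
    (1# + m ×′ 1#) - (1# + n ×′ 1#)  ≈⟨ +-cong (1+× m 1#) (-‿cong (1+× n 1#)) ⟨
    suc m ×′ 1# - suc n ×′ 1#        ∎

  +-homo : ∀ i j → ⟦ i ℤ.+ j ⟧ℤ ≈ ⟦ i ⟧ℤ + ⟦ j ⟧ℤ
  +-homo (+ m)    (+ n)    = ×-homo-+ 1# m n
  +-homo (+ m)    -[1+ n ] = ⊖-homo m (suc n)
  +-homo -[1+ m ] (+ n)    = trans (⊖-homo n (suc m)) (+-comm _ _)
  +-homo -[1+ m ] -[1+ n ] = begin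
    - (suc (suc (m ℕ.+ n)) ×′ 1#)      ≈⟨ -‿cong (×-cong (≡.cong suc (ℕ.+-suc m n)) refl) ⟨
    - ((suc m ℕ.+ suc n) ×′ 1#)        ≈⟨ -‿cong (×-homo-+ 1# (suc m) (suc n)) ⟩
    - (suc m ×′ 1# + suc n ×′ 1#)      ≈⟨ -‿+-comm _ _ ⟨
    - (suc m ×′ 1#) + - (suc n ×′ 1#)  ∎

  *-homo-+ : ∀ m j → ⟦ + m ℤ.* j ⟧ℤ ≈ ⟦ + m ⟧ℤ * ⟦ j ⟧ℤ
  *-homo-+ m (+ n)    = trans (≡⇒≈ (≡.sym (ℤ.pos-* m n))) (×1-homo-* m n)
  *-homo-+ m -[1+ n ] = begin
    ⟦ + m ℤ.* ℤ.- + suc n ⟧ℤ     ≈⟨ ≡⇒≈ (ℤ.neg-distribʳ-* (+ m) (+ suc n)) ⟨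
    ⟦ ℤ.- (+ m ℤ.* + suc n) ⟧ℤ   ≈⟨ -‿homo (+ m ℤ.* + suc n) ⟩
    - ⟦ + m ℤ.* + suc n ⟧ℤ       ≈⟨ -‿cong (*-homo-+ m (+ suc n)) ⟩
    - (m ×′ 1# * suc n ×′ 1#)    ≈⟨ -‿distribʳ-* _ _ ⟩
    m ×′ 1# * - (suc n ×′ 1#)    ∎

  *-homo : ∀ i j → ⟦ i ℤ.* j ⟧ℤ ≈ ⟦ i ⟧ℤ * ⟦ j ⟧ℤ
  *-homo (+ m)    j = *-homo-+ m j
  *-homo -[1+ m ] j = begin
    ⟦ ℤ.- + suc m ℤ.* j ⟧ℤ      ≈⟨ ≡⇒≈ (ℤ.neg-distribˡ-* (+ suc m) j) ⟨
    ⟦ ℤ.- (+ suc m ℤ.* j) ⟧ℤ    ≈⟨ -‿homo (+ suc m ℤ.* j) ⟩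
    - ⟦ + suc m ℤ.* j ⟧ℤ        ≈⟨ -‿cong (*-homo-+ (suc m) j) ⟩
    - (suc m ×′ 1# * ⟦ j ⟧ℤ)    ≈⟨ -‿distribˡ-* _ _ ⟩
    - (suc m ×′ 1#) * ⟦ j ⟧ℤ    ∎

  homomorphism : ℤ.+-*-rawRing ACR.-Raw-AlmostCommutative⟶ ACR.fromCommutativeRing R
  homomorphism = record
    { ⟦_⟧ = ⟦_⟧ℤ ; +-homo = +-homo ; *-homo = *-homo ; -‿homo = -‿homo
    ; 0-homo = refl ; 1-homo = refl }

  coefficient≟ : ∀ i j → Maybe (⟦ i ⟧ℤ ≈ ⟦ j ⟧ℤ)
  coefficient≟ i j with i ℤ.≟ j
  ... | yes i≡j = just (≡⇒≈ i≡j)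
  ... | no _    = nothing

  open import Algebra.Solver.Ring ℤ.+-*-rawRing (ACR.fromCommutativeRing R) homomorphism coefficient≟ public

module RingProperties {c ℓ : Level} (R : CommutativeRing c ℓ) where
  open CommutativeRing R
  open import Algebra.Properties.Ring ring using (-0#≈0#; -‿injective)
  open IntegerCoefficientSolver R

  1x+0y+0z≈x : ∀ x y z → 1# * x + 0# * y + 0# * z ≈ x
  1x+0y+0z≈x = solve 3 (λ x y z → con (+ 1) :* x :+ con (+ 0) :* y :+ con (+ 0) :* z := x) refl

  0x+1y+0z≈y : ∀ x y z → 0# * x + 1# * y + 0# * z ≈ y
  0x+1y+0z≈y = solve 3 (λ x y z → con (+ 0) :* x :+ con (+ 1) :* y :+ con (+ 0) :* z := y) refl

  0x+0y+1z≈z : ∀ x y z → 0# * x + 0# * y + 1# * z ≈ z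
  0x+0y+1z≈z = solve 3 (λ x y z → con (+ 0) :* x :+ con (+ 0) :* y :+ con (+ 1) :* z := z) refl

  x≈0⇒k*x≈0 : ∀ {x} k → x ≈ 0# → k * x ≈ 0#
  x≈0⇒k*x≈0 k x≈0 = trans (*-congˡ x≈0) (zeroʳ k)

  x≈0⇒x*k≈0 : ∀ {x} k → x ≈ 0# → x * k ≈ 0#
  x≈0⇒x*k≈0 k x≈0 = trans (*-congʳ x≈0) (zeroˡ k)

  x≈0∧y≈0⇒x+y≈0 : ∀ {x y} → x ≈ 0# → y ≈ 0# → x + y ≈ 0#
  x≈0∧y≈0⇒x+y≈0 x≈0 y≈0 = trans (+-cong x≈0 y≈0) (+-identityʳ 0#)

  x≈0⇒-x≈0 : ∀ {x} → x ≈ 0# → - x ≈ 0#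
  x≈0⇒-x≈0 x≈0 = trans (-‿cong x≈0) -0#≈0#

  x≈0∧y≈0⇒x-y≈0 : ∀ {x y} → x ≈ 0# → y ≈ 0# → x - y ≈ 0#
  x≈0∧y≈0⇒x-y≈0 x≈0 y≈0 = x≈0∧y≈0⇒x+y≈0 x≈0 (x≈0⇒-x≈0 y≈0)

  -x≈0⇒x≈0 : ∀ {x} → - x ≈ 0# → x ≈ 0#
  -x≈0⇒x≈0 -x≈0 = -‿injective (trans -x≈0 (sym -0#≈0#))

  x+y≈0∧x≈0⇒y≈0 : ∀ {x y} → x + y ≈ 0# → x ≈ 0# → y ≈ 0#
  x+y≈0∧x≈0⇒y≈0 {y = y} x+y≈0 x≈0 = trans (sym (+-identityˡ y)) (trans (+-congʳ (sym x≈0)) x+y≈0)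

  x+y≈0∧y≈0⇒x≈0 : ∀ {x y} → x + y ≈ 0# → y ≈ 0# → x ≈ 0#
  x+y≈0∧y≈0⇒x≈0 {x} x+y≈0 y≈0 = trans (sym (+-identityʳ x)) (trans (+-congˡ (sym y≈0)) x+y≈0)

  combination₂≈0 : ∀ {p q k l} → p ≈ 0# → q ≈ 0# → p * k + q * l ≈ 0#
  combination₂≈0 p≈0 q≈0 = x≈0∧y≈0⇒x+y≈0 (x≈0⇒x*k≈0 _ p≈0) (x≈0⇒x*k≈0 _ q≈0)

  combination₃≈0 : ∀ {p q r k l m} → p ≈ 0# → q ≈ 0# → r ≈ 0# → p * k + q * l + r * m ≈ 0#
  combination₃≈0 p≈0 q≈0 r≈0 = x≈0∧y≈0⇒x+y≈0 (combination₂≈0 p≈0 q≈0) (x≈0⇒x*k≈0 _ r≈0)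

module FieldProperties {a ℓ : Level} (F : Field a ℓ) where
  open Field F
  open import Relation.Binary.Reasoning.Setoid setoid

  divide : ∀ {x} → x ≉ 0# → Carrier → Carrier
  divide {x} x≉0 y = proj₁ (inverse x x≉0) * y

  *-divide : ∀ {x} (x≉0 : x ≉ 0#) y → x * divide x≉0 y ≈ y
  *-divide {x} x≉0 y = begin
    x * (x⁻¹ * y)  ≈⟨ *-assoc x x⁻¹ y ⟨
    x * x⁻¹ * y    ≈⟨ *-congʳ (proj₂ (inverse x x≉0)) ⟩
    1# * y         ≈⟨ *-identityˡ y ⟩
    y              ∎
    where x⁻¹ = proj₁ (inverse x x≉0)

  divide-* : ∀ {x} (x≉0 : x ≉ 0#) y → divide x≉0 (x * y) ≈ y
  divide-* {x} x≉0 y = begin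
    x⁻¹ * (x * y)  ≈⟨ *-assoc x⁻¹ x y ⟨
    x⁻¹ * x * y    ≈⟨ *-congʳ (*-comm x⁻¹ x) ⟩
    x * x⁻¹ * y    ≈⟨ *-congʳ (proj₂ (inverse x x≉0)) ⟩
    1# * y         ≈⟨ *-identityˡ y ⟩
    y              ∎
    where x⁻¹ = proj₁ (inverse x x≉0)

  *-cancelˡ : ∀ {x y z} → x ≉ 0# → x * y ≈ x * z → y ≈ z
  *-cancelˡ {y = y} {z} x≉0 xy≈xz = begin
    y                    ≈⟨ divide-* x≉0 y ⟨
    divide x≉0 (_ * y)   ≈⟨ *-congˡ xy≈xz ⟩
    divide x≉0 (_ * z)   ≈⟨ divide-* x≉0 z ⟩
    z                    ∎

  x*y≈0⇒y≈0 : ∀ {x y} → x ≉ 0# → x * y ≈ 0# → y ≈ 0#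
  x*y≈0⇒y≈0 x≉0 xy≈0 = *-cancelˡ x≉0 (trans xy≈0 (sym (zeroʳ _)))

  x*y≉0 : ∀ {x y} → x ≉ 0# → y ≉ 0# → x * y ≉ 0#
  x*y≉0 x≉0 y≉0 xy≈0 = y≉0 (x*y≈0⇒y≈0 x≉0 xy≈0)

  *-+-cancelˡ : ∀ {k x x′ y y′} → k ≉ 0# → x ≈ x′ → k * y + x ≈ k * y′ + x′ → y ≈ y′
  *-+-cancelˡ {x = x} k≉0 x≈x′ eq = *-cancelˡ k≉0 (+-cancelʳ x _ _ (trans eq (+-congˡ (sym x≈x′))))
    where open import Algebra.Properties.Ring ring using (+-cancelʳ)

module SymmetricBilinearForms {a ℓ : Level} (F : Field a ℓ) where
  open Field F
  open RingProperties commutativeRing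
  open FieldProperties F
  open IntegerCoefficientSolver commutativeRing

  form : (α β γ u₁ u₂ v₁ v₂ : Carrier) → Carrier
  form α β γ u₁ u₂ v₁ v₂ = α * (u₁ * v₁) + β * (u₂ * v₂) + γ * (u₁ * v₂ + v₁ * u₂)

  det : (u₁ u₂ v₁ v₂ : Carrier) → Carrier
  det u₁ u₂ v₁ v₂ = u₁ * v₂ - v₁ * u₂

  -- With M = [[α, γ], [γ, β]] and V = [u v], the Gram matrix is G = Vᵀ M V, and
  -- (adjα, adjγ; adjγ, adjβ) are the entries of adj(V)ᵀ G adj(V) = det² M.
  adjα adjβ adjγ : (u₁ u₂ v₁ v₂ P R S : Carrier) → Carrier
  adjα u₁ u₂ v₁ v₂ P R S = P * (v₂ * v₂) + R * (- (v₂ * u₂) - v₂ * u₂) + S * (u₂ * u₂)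
  adjβ u₁ u₂ v₁ v₂ P R S = P * (v₁ * v₁) + R * (- (v₁ * u₁) - v₁ * u₁) + S * (u₁ * u₁)
  adjγ u₁ u₂ v₁ v₂ P R S = P * (- (v₂ * v₁)) + R * (v₂ * u₁ + u₂ * v₁) + S * (- (u₂ * u₁))

  adjForm : (u₁ u₂ v₁ v₂ P R S x₁ x₂ y₁ y₂ : Carrier) → Carrier
  adjForm u₁ u₂ v₁ v₂ P R S = form (adjα u₁ u₂ v₁ v₂ P R S) (adjβ u₁ u₂ v₁ v₂ P R S) (adjγ u₁ u₂ v₁ v₂ P R S)

  formₚ : ∀ {n} (α β γ u₁ u₂ v₁ v₂ : Polynomial n) → Polynomial n
  formₚ α β γ u₁ u₂ v₁ v₂ = α :* (u₁ :* v₁) :+ β :* (u₂ :* v₂) :+ γ :* (u₁ :* v₂ :+ v₁ :* u₂)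

  private
    det²ₚ : ∀ {n} (u₁ u₂ v₁ v₂ : Polynomial n) → Polynomial n
    det²ₚ u₁ u₂ v₁ v₂ = (u₁ :* v₂ :- v₁ :* u₂) :* (u₁ :* v₂ :- v₁ :* u₂)

    adjαₚ adjβₚ adjγₚ : ∀ {n} (u₁ u₂ v₁ v₂ P R S : Polynomial n) → Polynomial n
    adjαₚ u₁ u₂ v₁ v₂ P R S = P :* (v₂ :* v₂) :+ R :* (:- (v₂ :* u₂) :- v₂ :* u₂) :+ S :* (u₂ :* u₂)
    adjβₚ u₁ u₂ v₁ v₂ P R S = P :* (v₁ :* v₁) :+ R :* (:- (v₁ :* u₁) :- v₁ :* u₁) :+ S :* (u₁ :* u₁)
    adjγₚ u₁ u₂ v₁ v₂ P R S = P :* (:- (v₂ :* v₁)) :+ R :* (v₂ :* u₁ :+ u₂ :* v₁) :+ S :* (:- (u₂ :* u₁))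

    adjFormₚ : ∀ {n} (u₁ u₂ v₁ v₂ P R S x₁ x₂ y₁ y₂ : Polynomial n) → Polynomial n
    adjFormₚ u₁ u₂ v₁ v₂ P R S =
      formₚ (adjαₚ u₁ u₂ v₁ v₂ P R S) (adjβₚ u₁ u₂ v₁ v₂ P R S) (adjγₚ u₁ u₂ v₁ v₂ P R S)

  det²*α≈adjα : ∀ α β γ u₁ u₂ v₁ v₂ → det u₁ u₂ v₁ v₂ * det u₁ u₂ v₁ v₂ * α ≈
    adjα u₁ u₂ v₁ v₂ (form α β γ u₁ u₂ u₁ u₂) (form α β γ v₁ v₂ u₁ u₂) (form α β γ v₁ v₂ v₁ v₂)
  det²*α≈adjα = solve 7 (λ α β γ u₁ u₂ v₁ v₂ → det²ₚ u₁ u₂ v₁ v₂ :* α :=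
    adjαₚ u₁ u₂ v₁ v₂ (formₚ α β γ u₁ u₂ u₁ u₂) (formₚ α β γ v₁ v₂ u₁ u₂) (formₚ α β γ v₁ v₂ v₁ v₂)) refl

  det²*β≈adjβ : ∀ α β γ u₁ u₂ v₁ v₂ → det u₁ u₂ v₁ v₂ * det u₁ u₂ v₁ v₂ * β ≈
    adjβ u₁ u₂ v₁ v₂ (form α β γ u₁ u₂ u₁ u₂) (form α β γ v₁ v₂ u₁ u₂) (form α β γ v₁ v₂ v₁ v₂)
  det²*β≈adjβ = solve 7 (λ α β γ u₁ u₂ v₁ v₂ → det²ₚ u₁ u₂ v₁ v₂ :* β :=
    adjβₚ u₁ u₂ v₁ v₂ (formₚ α β γ u₁ u₂ u₁ u₂) (formₚ α β γ v₁ v₂ u₁ u₂) (formₚ α β γ v₁ v₂ v₁ v₂)) refl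

  det²*γ≈adjγ : ∀ α β γ u₁ u₂ v₁ v₂ → det u₁ u₂ v₁ v₂ * det u₁ u₂ v₁ v₂ * γ ≈
    adjγ u₁ u₂ v₁ v₂ (form α β γ u₁ u₂ u₁ u₂) (form α β γ v₁ v₂ u₁ u₂) (form α β γ v₁ v₂ v₁ v₂)
  det²*γ≈adjγ = solve 7 (λ α β γ u₁ u₂ v₁ v₂ → det²ₚ u₁ u₂ v₁ v₂ :* γ :=
    adjγₚ u₁ u₂ v₁ v₂ (formₚ α β γ u₁ u₂ u₁ u₂) (formₚ α β γ v₁ v₂ u₁ u₂) (formₚ α β γ v₁ v₂ v₁ v₂)) refl

  form-determined : ∀ {α β γ u₁ u₂ v₁ v₂} → det u₁ u₂ v₁ v₂ ≉ 0# →
    form α β γ u₁ u₂ u₁ u₂ ≈ 0# → form α β γ v₁ v₂ u₁ u₂ ≈ 0# → form α β γ v₁ v₂ v₁ v₂ ≈ 0# →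
    α ≈ 0# × β ≈ 0# × γ ≈ 0#
  form-determined {α} {β} {γ} {u₁} {u₂} {v₁} {v₂} det≉0 uu≈0 vu≈0 vv≈0 =
      vanishes (det²*α≈adjα α β γ u₁ u₂ v₁ v₂)
    , vanishes (det²*β≈adjβ α β γ u₁ u₂ v₁ v₂)
    , vanishes (det²*γ≈adjγ α β γ u₁ u₂ v₁ v₂)
    where
    vanishes : ∀ {κ k l m} → det u₁ u₂ v₁ v₂ * det u₁ u₂ v₁ v₂ * κ ≈
      form α β γ u₁ u₂ u₁ u₂ * k + form α β γ v₁ v₂ u₁ u₂ * l + form α β γ v₁ v₂ v₁ v₂ * m → κ ≈ 0#
    vanishes eq = x*y≈0⇒y≈0 (x*y≉0 det≉0 det≉0) (trans eq (combination₃≈0 uu≈0 vu≈0 vv≈0))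

  adjForm-uu : ∀ u₁ u₂ v₁ v₂ P R S →
    adjForm u₁ u₂ v₁ v₂ P R S u₁ u₂ u₁ u₂ ≈ det u₁ u₂ v₁ v₂ * det u₁ u₂ v₁ v₂ * P
  adjForm-uu = solve 7 (λ u₁ u₂ v₁ v₂ P R S →
    adjFormₚ u₁ u₂ v₁ v₂ P R S u₁ u₂ u₁ u₂ := det²ₚ u₁ u₂ v₁ v₂ :* P) refl

  adjForm-vu : ∀ u₁ u₂ v₁ v₂ P R S →
    adjForm u₁ u₂ v₁ v₂ P R S v₁ v₂ u₁ u₂ ≈ det u₁ u₂ v₁ v₂ * det u₁ u₂ v₁ v₂ * R
  adjForm-vu = solve 7 (λ u₁ u₂ v₁ v₂ P R S →
    adjFormₚ u₁ u₂ v₁ v₂ P R S v₁ v₂ u₁ u₂ := det²ₚ u₁ u₂ v₁ v₂ :* R) refl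

  adjForm-vv : ∀ u₁ u₂ v₁ v₂ P R S →
    adjForm u₁ u₂ v₁ v₂ P R S v₁ v₂ v₁ v₂ ≈ det u₁ u₂ v₁ v₂ * det u₁ u₂ v₁ v₂ * S
  adjForm-vv = solve 7 (λ u₁ u₂ v₁ v₂ P R S →
    adjFormₚ u₁ u₂ v₁ v₂ P R S v₁ v₂ v₁ v₂ := det²ₚ u₁ u₂ v₁ v₂ :* S) refl

  form-scale : ∀ w α β γ u₁ u₂ v₁ v₂ →
    form (w * α) (w * β) (w * γ) u₁ u₂ v₁ v₂ ≈ w * form α β γ u₁ u₂ v₁ v₂
  form-scale = solve 8 (λ w α β γ u₁ u₂ v₁ v₂ →
    formₚ (w :* α) (w :* β) (w :* γ) u₁ u₂ v₁ v₂ := w :* formₚ α β γ u₁ u₂ v₁ v₂) refl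

  form-interpolation : ∀ {u₁ u₂ v₁ v₂} → det u₁ u₂ v₁ v₂ ≉ 0# → ∀ P R S →
    ∃ λ α → ∃ λ β → ∃ λ γ →
      form α β γ u₁ u₂ u₁ u₂ ≈ P × form α β γ v₁ v₂ u₁ u₂ ≈ R × form α β γ v₁ v₂ v₁ v₂ ≈ S
  form-interpolation {u₁} {u₂} {v₁} {v₂} det≉0 P R S =
      divide det²≉0 (adjα u₁ u₂ v₁ v₂ P R S)
    , divide det²≉0 (adjβ u₁ u₂ v₁ v₂ P R S)
    , divide det²≉0 (adjγ u₁ u₂ v₁ v₂ P R S)
    , rescale (adjForm-uu u₁ u₂ v₁ v₂ P R S)
    , rescale (adjForm-vu u₁ u₂ v₁ v₂ P R S)
    , rescale (adjForm-vv u₁ u₂ v₁ v₂ P R S)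
    where
    det²≉0 = x*y≉0 det≉0 det≉0
    w = proj₁ (inverse _ det²≉0)

    rescale : ∀ {x₁ x₂ y₁ y₂ Q} →
      adjForm u₁ u₂ v₁ v₂ P R S x₁ x₂ y₁ y₂ ≈ det u₁ u₂ v₁ v₂ * det u₁ u₂ v₁ v₂ * Q →
      form (divide det²≉0 (adjα u₁ u₂ v₁ v₂ P R S)) (divide det²≉0 (adjβ u₁ u₂ v₁ v₂ P R S))
           (divide det²≉0 (adjγ u₁ u₂ v₁ v₂ P R S)) x₁ x₂ y₁ y₂ ≈ Q
    rescale {Q = Q} eq =
      trans (form-scale w _ _ _ _ _ _ _) (trans (*-congˡ eq) (divide-* det²≉0 Q))

module Recurrences {a ℓ : Level} (F : Field a ℓ) (b c : Seq F) where
  open Field F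
  open RingProperties commutativeRing
  open FieldProperties F
  open IntegerCoefficientSolver commutativeRing
  open SymmetricBilinearForms F
  open import Algebra.Properties.Ring ring using (x∙y⁻¹≈ε⇒x≈y; x≈y⇒x∙y⁻¹≈ε)

  Sol3-combination : ∀ {y w} k l → Sol3 F b c y → Sol3 F b c w → Sol3 F b c (λ n → k * y n + l * w n)
  Sol3-combination k l sol-y sol-w m = trans (regroup k l _ _ _ _ _ _ _ _ _) (combination₂≈0 (sol-y m) (sol-w m))
    where
    regroup : ∀ k l b₁ c₀ c₁ y₀ y₁ y₂ w₀ w₁ w₂ →
      c₁ * (k * y₂ + l * w₂) + c₀ * (k * y₀ + l * w₀) - b₁ * (k * y₁ + l * w₁)
      ≈ (c₁ * y₂ + c₀ * y₀ - b₁ * y₁) * k + (c₁ * w₂ + c₀ * w₀ - b₁ * w₁) * l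
    regroup = solve 11 (λ k l b₁ c₀ c₁ y₀ y₁ y₂ w₀ w₁ w₂ →
      c₁ :* (k :* y₂ :+ l :* w₂) :+ c₀ :* (k :* y₀ :+ l :* w₀) :- b₁ :* (k :* y₁ :+ l :* w₁)
      := (c₁ :* y₂ :+ c₀ :* y₀ :- b₁ :* y₁) :* k :+ (c₁ :* w₂ :+ c₀ :* w₀ :- b₁ :* w₁) :* l) refl

  Sol3-vanishing : (∀ n → c n ≉ 0#) → ∀ {y} → Sol3 F b c y → y 0 ≈ 0# → y 1 ≈ 0# → ∀ n → y n ≈ 0#
  Sol3-vanishing c≉0 {y} sol y₀≈0 y₁≈0 n = proj₁ (vanishes n)
    where
    isolate : ∀ b₁ c₀ c₁ y₀ y₁ y₂ → c₁ * y₂ ≈ (c₁ * y₂ + c₀ * y₀ - b₁ * y₁) * 1# + y₀ * (- c₀) + y₁ * b₁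
    isolate = solve 6 (λ b₁ c₀ c₁ y₀ y₁ y₂ →
      c₁ :* y₂ := (c₁ :* y₂ :+ c₀ :* y₀ :- b₁ :* y₁) :* con (+ 1) :+ y₀ :* (:- c₀) :+ y₁ :* b₁) refl

    vanishes : ∀ n → y n ≈ 0# × y (suc n) ≈ 0#
    vanishes zero    = y₀≈0 , y₁≈0
    vanishes (suc n) = let yₙ≈0 , yₙ₊₁≈0 = vanishes n in
      yₙ₊₁≈0 , x*y≈0⇒y≈0 (c≉0 (suc n)) (trans (isolate _ _ _ _ _ _) (combination₃≈0 (sol n) yₙ≈0 yₙ₊₁≈0))

  Sol4-resp : ∀ {y z} → (∀ n → y n ≈ z n) → Sol4 F b c y → Sol4 F b c z
  Sol4-resp y≈z sol m = trans (sym (+-cong (+-cong (+-cong (*-congˡ (y≈z _)) (*-congˡ (y≈z _)))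
                                                  (*-congˡ (y≈z _)))
                                           (-‿cong (*-congˡ (y≈z _)))))
                              (sol m)

  record Companion (t p : Seq F) : Set ℓ where
    field
      adjacent : ∀ n → b (suc n) * p (suc n) ≈ c (suc n) * t (suc n) + c n * t n
      diagonal : ∀ n → c n * c n * p n ≈
        c (suc n) * c (suc n) * p (suc (suc n)) - b (suc n) * (c (suc n) * t (suc n) - c n * t n)

  four-term-elimination : ∀ b₀ b₁ b₂ c₋ c₀ c₁ c₂ t₋ t₀ t₁ t₂ p₀ p₂ →
      c₂ * (c₁ * c₁) * b₀ * t₂
    + (b₀ * (c₁ * c₁ * c₁) - b₀ * b₁ * b₂ * c₁) * t₁
    + (b₀ * b₁ * b₂ * c₀ - b₂ * (c₀ * c₀ * c₀)) * t₀
    - c₋ * (c₀ * c₀) * b₂ * t₋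
    + b₀ * b₂ * (c₀ * c₀ * p₀ - (c₁ * c₁ * p₂ - b₁ * (c₁ * t₁ - c₀ * t₀)))
    ≈ (b₂ * p₂ - (c₂ * t₂ + c₁ * t₁)) * (- (b₀ * c₁ * c₁))
    + (b₀ * p₀ - (c₀ * t₀ + c₋ * t₋)) * (c₀ * c₀ * b₂)
  four-term-elimination = solve 13 (λ b₀ b₁ b₂ c₋ c₀ c₁ c₂ t₋ t₀ t₁ t₂ p₀ p₂ →
       c₂ :* (c₁ :* c₁) :* b₀ :* t₂
    :+ (b₀ :* (c₁ :* c₁ :* c₁) :- b₀ :* b₁ :* b₂ :* c₁) :* t₁
    :+ (b₀ :* b₁ :* b₂ :* c₀ :- b₂ :* (c₀ :* c₀ :* c₀)) :* t₀
    :- c₋ :* (c₀ :* c₀) :* b₂ :* t₋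
    :+ b₀ :* b₂ :* (c₀ :* c₀ :* p₀ :- (c₁ :* c₁ :* p₂ :- b₁ :* (c₁ :* t₁ :- c₀ :* t₀)))
    := (b₂ :* p₂ :- (c₂ :* t₂ :+ c₁ :* t₁)) :* (:- (b₀ :* c₁ :* c₁))
    :+ (b₀ :* p₀ :- (c₀ :* t₀ :+ c₋ :* t₋)) :* (c₀ :* c₀ :* b₂)) refl

  companion⇒Sol4 : ∀ {t p} → Companion t p → Sol4 F b c t
  companion⇒Sol4 comp m = x+y≈0∧y≈0⇒x≈0
    (trans (four-term-elimination _ _ _ _ _ _ _ _ _ _ _ _ _)
           (combination₂≈0 (x≈y⇒x∙y⁻¹≈ε (adjacent (suc (suc m)))) (x≈y⇒x∙y⁻¹≈ε (adjacent m))))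
    (x≈0⇒k*x≈0 _ (x≈y⇒x∙y⁻¹≈ε (diagonal (suc m))))
    where open Companion comp

  module NonDegenerate (b≉0 : ∀ n → b (suc n) ≉ 0#) (c≉0 : ∀ n → c n ≉ 0#) where
    c²≉0 : ∀ n → c n * c n ≉ 0#
    c²≉0 n = x*y≉0 (c≉0 n) (c≉0 n)

    Sol4⇒companion : ∀ {t} → Sol4 F b c t → ∃ (Companion t)
    Sol4⇒companion {t} sol = p , record { adjacent = adjacent ; diagonal = diagonal }
      where
      p₊ : Seq F
      p₊ n = divide (b≉0 n) (c (suc n) * t (suc n) + c n * t n)

      -- p₀ is forced by the diagonal relation at 0; at later indices that relation
      -- follows from the four-term recurrence and the adjacent relations.
      p : Seq F
      p zero    = divide (c²≉0 0) (c 1 * c 1 * p₊ 1 - b 1 * (c 1 * t 1 - c 0 * t 0))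
      p (suc n) = p₊ n

      adjacent : ∀ n → b (suc n) * p (suc n) ≈ c (suc n) * t (suc n) + c n * t n
      adjacent n = *-divide (b≉0 n) _

      diagonal : ∀ n → c n * c n * p n ≈
        c (suc n) * c (suc n) * p (suc (suc n)) - b (suc n) * (c (suc n) * t (suc n) - c n * t n)
      diagonal zero    = *-divide (c²≉0 0) _
      diagonal (suc m) = x∙y⁻¹≈ε⇒x≈y _ _ (x*y≈0⇒y≈0 (x*y≉0 (b≉0 m) (b≉0 (suc (suc m))))
        (x+y≈0∧x≈0⇒y≈0
          (trans (four-term-elimination _ _ _ _ _ _ _ _ _ _ _ _ _)
                 (combination₂≈0 (x≈y⇒x∙y⁻¹≈ε (adjacent (suc (suc m)))) (x≈y⇒x∙y⁻¹≈ε (adjacent m))))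
          (sol m)))

    companion-unique : ∀ {t p t′ p′} → Companion t p → Companion t′ p′ →
      t 0 ≈ t′ 0 → p 0 ≈ p′ 0 → p 1 ≈ p′ 1 → ∀ n → t n ≈ t′ n
    companion-unique {t} {p} {t′} {p′} comp comp′ t₀≈ p₀≈ p₁≈ n = proj₁ (agree n)
      where
      open import Relation.Binary.Reasoning.Setoid setoid
      module C = Companion comp
      module C′ = Companion comp′

      agree : ∀ n → t n ≈ t′ n × p n ≈ p′ n × p (suc n) ≈ p′ (suc n)
      agree zero    = t₀≈ , p₀≈ , p₁≈
      agree (suc n) = tₙ₊₁≈ , pₙ₊₁≈ , pₙ₊₂≈
        where
        tₙ≈ = proj₁ (agree n)
        pₙ≈ = proj₁ (proj₂ (agree n))
        pₙ₊₁≈ = proj₂ (proj₂ (agree n))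

        tₙ₊₁≈ : t (suc n) ≈ t′ (suc n)
        tₙ₊₁≈ = *-+-cancelˡ (c≉0 (suc n)) (*-congˡ tₙ≈) (begin
          c (suc n) * t (suc n) + c n * t n     ≈⟨ C.adjacent n ⟨
          b (suc n) * p (suc n)                 ≈⟨ *-congˡ pₙ₊₁≈ ⟩
          b (suc n) * p′ (suc n)                ≈⟨ C′.adjacent n ⟩
          c (suc n) * t′ (suc n) + c n * t′ n   ∎)

        pₙ₊₂≈ : p (suc (suc n)) ≈ p′ (suc (suc n))
        pₙ₊₂≈ = *-+-cancelˡ (c²≉0 (suc n))
          (-‿cong (*-congˡ (+-cong (*-congˡ tₙ₊₁≈) (-‿cong (*-congˡ tₙ≈)))))
          (trans (sym (C.diagonal n)) (trans (*-congˡ pₙ≈) (C′.diagonal n)))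

    companion-of-zero : ∀ {t p} → Companion t p → (∀ n → t n ≈ 0#) → ∀ n → p n ≈ 0#
    companion-of-zero {t} {p} comp t≈0 = vanishes
      where
      open Companion comp

      vanishes₊ : ∀ n → p (suc n) ≈ 0#
      vanishes₊ n = x*y≈0⇒y≈0 (b≉0 n)
        (trans (adjacent n) (x≈0∧y≈0⇒x+y≈0 (x≈0⇒k*x≈0 _ (t≈0 _)) (x≈0⇒k*x≈0 _ (t≈0 _))))

      vanishes : ∀ n → p n ≈ 0#
      vanishes zero    = x*y≈0⇒y≈0 (c²≉0 0) (trans (diagonal 0) (x≈0∧y≈0⇒x-y≈0
        (x≈0⇒k*x≈0 _ (vanishes₊ 1))
        (x≈0⇒k*x≈0 _ (x≈0∧y≈0⇒x-y≈0 (x≈0⇒k*x≈0 _ (t≈0 1)) (x≈0⇒k*x≈0 _ (t≈0 0))))))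
      vanishes (suc n) = vanishes₊ n

  module FormsAlong {A B : Seq F} (sol-A : Sol3 F b c A) (sol-B : Sol3 F b c B) where
    adjacentForm diagonalForm : (α β γ : Carrier) → Seq F
    adjacentForm α β γ n = form α β γ (A (suc n)) (B (suc n)) (A n) (B n)
    diagonalForm α β γ n = form α β γ (A n) (B n) (A n) (B n)

    form-companion : ∀ α β γ → Companion (adjacentForm α β γ) (diagonalForm α β γ)
    form-companion α β γ = record
      { adjacent = λ n → x∙y⁻¹≈ε⇒x≈y _ _
          (trans (adjacent-gap α β γ _ _ _ _ _ _ _ _ _) (combination₂≈0 (sol-A n) (sol-B n)))
      ; diagonal = λ n → x∙y⁻¹≈ε⇒x≈y _ _
          (trans (diagonal-gap α β γ _ _ _ _ _ _ _ _ _) (combination₂≈0 (sol-A n) (sol-B n)))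
      }
      where
      adjacent-gap : ∀ α β γ b₁ c₀ c₁ A₀ A₁ A₂ B₀ B₁ B₂ →
        b₁ * form α β γ A₁ B₁ A₁ B₁ - (c₁ * form α β γ A₂ B₂ A₁ B₁ + c₀ * form α β γ A₁ B₁ A₀ B₀)
        ≈ (c₁ * A₂ + c₀ * A₀ - b₁ * A₁) * (- (α * A₁ + γ * B₁))
        + (c₁ * B₂ + c₀ * B₀ - b₁ * B₁) * (- (β * B₁ + γ * A₁))
      adjacent-gap = solve 12 (λ α β γ b₁ c₀ c₁ A₀ A₁ A₂ B₀ B₁ B₂ →
        b₁ :* formₚ α β γ A₁ B₁ A₁ B₁ :- (c₁ :* formₚ α β γ A₂ B₂ A₁ B₁ :+ c₀ :* formₚ α β γ A₁ B₁ A₀ B₀)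
        := (c₁ :* A₂ :+ c₀ :* A₀ :- b₁ :* A₁) :* (:- (α :* A₁ :+ γ :* B₁))
        :+ (c₁ :* B₂ :+ c₀ :* B₀ :- b₁ :* B₁) :* (:- (β :* B₁ :+ γ :* A₁))) refl

      diagonal-gap : ∀ α β γ b₁ c₀ c₁ A₀ A₁ A₂ B₀ B₁ B₂ →
        c₀ * c₀ * form α β γ A₀ B₀ A₀ B₀
        - (c₁ * c₁ * form α β γ A₂ B₂ A₂ B₂
           - b₁ * (c₁ * form α β γ A₂ B₂ A₁ B₁ - c₀ * form α β γ A₁ B₁ A₀ B₀))
        ≈ (c₁ * A₂ + c₀ * A₀ - b₁ * A₁) * (- (α * (c₁ * A₂ - c₀ * A₀) + γ * (c₁ * B₂ - c₀ * B₀)))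
        + (c₁ * B₂ + c₀ * B₀ - b₁ * B₁) * (- (β * (c₁ * B₂ - c₀ * B₀) + γ * (c₁ * A₂ - c₀ * A₀)))
      diagonal-gap = solve 12 (λ α β γ b₁ c₀ c₁ A₀ A₁ A₂ B₀ B₁ B₂ →
        c₀ :* c₀ :* formₚ α β γ A₀ B₀ A₀ B₀
        :- (c₁ :* c₁ :* formₚ α β γ A₂ B₂ A₂ B₂
            :- b₁ :* (c₁ :* formₚ α β γ A₂ B₂ A₁ B₁ :- c₀ :* formₚ α β γ A₁ B₁ A₀ B₀))
        := (c₁ :* A₂ :+ c₀ :* A₀ :- b₁ :* A₁) :* (:- (α :* (c₁ :* A₂ :- c₀ :* A₀) :+ γ :* (c₁ :* B₂ :- c₀ :* B₀)))
        :+ (c₁ :* B₂ :+ c₀ :* B₀ :- b₁ :* B₁) :* (:- (β :* (c₁ :* B₂ :- c₀ :* B₀) :+ γ :* (c₁ :* A₂ :- c₀ :* A₀)))) refl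

  module ProductBasis (b≉0 : ∀ n → b (suc n) ≉ 0#) (c≉0 : ∀ n → c n ≉ 0#)
    {A B : Seq F} (sol-A : Sol3 F b c A) (sol-B : Sol3 F b c B)
    (independent : ∀ α β → (∀ n → α * A n + β * B n ≈ 0#) → α ≈ 0# × β ≈ 0#) where
    open NonDegenerate b≉0 c≉0
    open FormsAlong sol-A sol-B

    -- If the Casoratian vanished, B₀A − A₀B and B₁A − A₁B would vanish at 0 and 1, forcing
    -- A₀ = B₀ = A₁ = B₁ = 0; then A + B vanishes at 0 and 1 too, contradicting independence.
    casoratian≉0 : det (A 0) (B 0) (A 1) (B 1) ≉ 0#
    casoratian≉0 W≈0 = 0≉1 (sym (proj₁ (initially-independent 1# 1# (1x+1y≈0 A₀≈0 B₀≈0) (1x+1y≈0 A₁≈0 B₁≈0))))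
      where
      initially-independent : ∀ k l → k * A 0 + l * B 0 ≈ 0# → k * A 1 + l * B 1 ≈ 0# → k ≈ 0# × l ≈ 0#
      initially-independent k l at₀ at₁ =
        independent k l (Sol3-vanishing c≉0 (Sol3-combination k l sol-A sol-B) at₀ at₁)

      cross-same : ∀ x y → y * x + (- x) * y ≈ 0#
      cross-same = solve 2 (λ x y → y :* x :+ (:- x) :* y := con (+ 0)) refl

      cross₀₁ : ∀ x₀ y₀ x₁ y₁ → y₀ * x₁ + (- x₀) * y₁ ≈ - det x₀ y₀ x₁ y₁
      cross₀₁ = solve 4 (λ x₀ y₀ x₁ y₁ → y₀ :* x₁ :+ (:- x₀) :* y₁ := :- (x₀ :* y₁ :- x₁ :* y₀)) refl

      cross₁₀ : ∀ x₀ y₀ x₁ y₁ → y₁ * x₀ + (- x₁) * y₀ ≈ det x₀ y₀ x₁ y₁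
      cross₁₀ = solve 4 (λ x₀ y₀ x₁ y₁ → y₁ :* x₀ :+ (:- x₁) :* y₀ := x₀ :* y₁ :- x₁ :* y₀) refl

      B₀≈0×-A₀≈0 : B 0 ≈ 0# × - A 0 ≈ 0#
      B₀≈0×-A₀≈0 = initially-independent (B 0) (- A 0)
        (cross-same _ _) (trans (cross₀₁ _ _ _ _) (x≈0⇒-x≈0 W≈0))

      B₁≈0×-A₁≈0 : B 1 ≈ 0# × - A 1 ≈ 0#
      B₁≈0×-A₁≈0 = initially-independent (B 1) (- A 1)
        (trans (cross₁₀ _ _ _ _) W≈0) (cross-same _ _)

      A₀≈0 = -x≈0⇒x≈0 (proj₂ B₀≈0×-A₀≈0)
      B₀≈0 = proj₁ B₀≈0×-A₀≈0
      A₁≈0 = -x≈0⇒x≈0 (proj₂ B₁≈0×-A₁≈0)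
      B₁≈0 = proj₁ B₁≈0×-A₁≈0

      1x+1y≈0 : ∀ {x y} → x ≈ 0# → y ≈ 0# → 1# * x + 1# * y ≈ 0#
      1x+1y≈0 x≈0 y≈0 = x≈0∧y≈0⇒x+y≈0 (x≈0⇒k*x≈0 1# x≈0) (x≈0⇒k*x≈0 1# y≈0)

    adjacentForm-independent : ∀ α β γ → (∀ n → adjacentForm α β γ n ≈ 0#) → α ≈ 0# × β ≈ 0# × γ ≈ 0#
    adjacentForm-independent α β γ t≈0 =
      form-determined casoratian≉0 (p≈0 0) (t≈0 0) (p≈0 1)
      where p≈0 = companion-of-zero (form-companion α β γ) t≈0

    adjacentForm-spanning : ∀ z → Sol4 F b c z → ∃ λ α → ∃ λ β → ∃ λ γ → ∀ n → z n ≈ adjacentForm α β γ n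
    adjacentForm-spanning _ sol =
      let p , comp = Sol4⇒companion sol
          α , β , γ , uu≈ , vu≈ , vv≈ = form-interpolation casoratian≉0 (p 0) _ (p 1)
      in α , β , γ , companion-unique comp (form-companion α β γ) (sym vu≈) (sym uu≈) (sym vv≈)

theorem3p2 : {a ℓ : Level} (F : Field a ℓ) → CharZero F →
    (b c : Seq F) →
    (∀ n → ¬ Field._≈_ F (b (suc n)) (Field.0# F)) →
    (∀ n → ¬ Field._≈_ F (c n) (Field.0# F)) →
    (A B : Seq F) → Basis2 F (Sol3 F b c) A B →
    Basis3 F (Sol4 F b c)
      (λ m → Field._*_ F (A (suc m)) (A m))
      (λ m → Field._*_ F (B (suc m)) (B m))
      (λ m → Field._+_ F (Field._*_ F (A (suc m)) (B m)) (Field._*_ F (A m) (B (suc m))))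
theorem3p2 F _ b c b≉0 c≉0 A B (sol-A , sol-B , independent , _) =
    Sol4-resp (λ _ → 1x+0y+0z≈x _ _ _) (companion⇒Sol4 (form-companion 1# 0# 0#))
  , Sol4-resp (λ _ → 0x+1y+0z≈y _ _ _) (companion⇒Sol4 (form-companion 0# 1# 0#))
  , Sol4-resp (λ _ → 0x+0y+1z≈z _ _ _) (companion⇒Sol4 (form-companion 0# 0# 1#))
  , adjacentForm-independent
  , adjacentForm-spanning
  where
  open Field F
  open RingProperties commutativeRing
  open Recurrences F b c
  open FormsAlong sol-A sol-B
  open ProductBasis b≉0 c≉0 sol-A sol-B independent
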